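{- Let $(S^-_k,S^+_k,w)$ be an $\mathcal N_{BS-R}$-valid metastate at stage $k$ and $(S^-_{k+h},S^+_{k+h},w')$ an $\mathcal N_{BS-R}$-valid metastate at stage $k+h$, $h\ge0$. There is an arc from the first to the second in the meta graph if and only if one of the following holds: (a) $h=0$, $S^-_{k+h}=S^-_k$ and $S^+_{k+h}=S^+_k$; (b) $h\ge1$, the operation set $wHw'$ belongs to $\mathcal{OP}^*_{BS-R}$, where $H=\{v_l: l\in I\}$ with $I=(\{k+1,\dots,k+h\}\cup S^+_k\cup S^-_{k+h})\setminus(S^+_{k+h}\cup S^-_k)$, and simultaneously $\{j\in S^-_k: j>k+h\}\subseteq S^-_{k+h}$, $\{j\in S^-_k: j\le k+h\}\cap S^+_{k+h}=\emptyset$, and $\{j\in S^+_{k+h}: j\le k\}\subseteq S^+_k$.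
   Context: DRP-E data: destinations $V_d=\{v_1,\dots,v_{n_d}\}$, replenishment locations (RLs) $V_r$, drone flight times $c_d$, rover travel times $c_r$, maximal flight time $e_{max}$. An operation $wsw'=(w,v_{O1},\dots,v_{Ok},w')$ ($w,w'\in V_r$, $k\ge1$, distinct destinations, $\{s\}$ its destination set) has flight time $C_d=c_d(w,v_{O1})+\sum_{i<k}c_d(v_{Oi},v_{O(i+1)})+c_d(v_{Ok},w')$ and is feasible if $C_d\le e_{max}$. A drone tour is an alternating sequence of recharging legs (pairs of RLs) and operations, from $w_0$ to $w_t$, consecutive pieces connected, visiting each destination exactly once; $\pi_d(V_d)$ is the visiting order of destinations. For $x=(v_1,\dots,v_{n_d})$, $p\in\mathbb N$ and a permutation $\sigma$ of $[n_d]$ ($\sigma(i)$ = new position of $v_i$): $(v_{\sigma^{ -1}(1)},\dots)\in\mathcal N_{BS}(x,p)$ iff $\sigma(i)<\sigma(j)$ whenever $i+p\le j$; $\mathcal N_{BS-R}(x,p)$ = drone tours $\pi_d$ with $\pi_d(V_d)\in\mathcal N_{BS}(x,p)$; an operation is $\mathcal N_{BS-R}$-valid if it occurs in some drone tour of $\mathcal N_{BS-R}(x,p)$. For $w,w'\in V_r$, $S\subseteq V_d$ the operation set $wSw'$ is the set of feasible valid operations $wsw'$ with $\{s\}=S$; $\mathcal{OP}^*_{BS-R}$ is the collection of nonempty operation sets (with makespan $\max\{c_r(w,w'),\min C_d\}$). Meta graph: a metastate at stage $k$ is $(S,w)$, $S\subseteq V_d$, $|S|=k$, $w\in V_r$,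 valid iff some sequence of $\mathcal N_{BS}(x,p)$ has first $k$ entries forming $S$. Between valid metastates there is an arc $(S,w)\to(T,w')$ iff either $S=T$ (recharging leg $(w,w')$) or $S\subsetneq T$ and the operation set $w(T\setminus S)w'\in\mathcal{OP}^*_{BS-R}$. Encoding: $(S,w)$ at stage $k$ is written $(S^-_k,S^+_k,w)$ with $S^-_k=\{l\ge k+1:v_l\in S\}$, $S^+_k=\{h\le k: v_h\notin S\}$, so $S=\{v_j:j\in([k]\setminus S^+_k)\cup S^-_k\}$.
   Formalization: The drone flight times $c_d$, rover travel times $c_r$ and maximal flight time $e_{max}$ take rational values instead of real ones. -}

module Defs where

open import Data.Nat as ℕ using (ℕ; zero; suc; _+_; _≤_; _<_; _<?_)
open import Data.Fin as Fin using (Fin; toℕ)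
open import Data.Fin.Subset using (Subset; ⁅_⁆; ⊥; _∪_; _∩_; _─_; ∣_∣; _⊆_; _⊂_; Empty)
open import Data.Fin.Permutation using (Permutation′; _⟨$⟩ʳ_; _⟨$⟩ˡ_)
open import Data.Vec as Vec using (tabulate)
open import Data.List as List using (List; []; _∷_; _++_; concatMap; allFin)
open import Data.List.Membership.Propositional as LMem using ()
open import Data.List.Relation.Unary.Unique.Propositional using (Unique)
open import Data.List.Relation.Unary.Linked using (Linked)
open import Data.List.Relation.Unary.All using (All)
open import Data.List.Relation.Binary.Permutation.Propositional using (_↭_)
open import Data.Rational as ℚ using (ℚ)
open import Data.Sum using (_⊎_; inj₁; inj₂)
open import Data.Product using (Σ; ∃; _×_; _,_)
open import Data.Bool using (Bool; true; false)
open import Data.Unit using (⊤)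
open import Relation.Nullary using (¬_; does)
open import Relation.Binary.PropositionalEquality using (_≡_; _≢_)

-- Instance data of DRP-E.
-- Destinations v_1,…,v_{n_d} are represented by Fin nd (v_l ↔ index l-1),
-- replenishment locations by Fin nr.  Times are rationals.

Node : ℕ → ℕ → Set
Node nd nr = Fin nd ⊎ Fin nr

record DRPE : Set where
  field
    nd   : ℕ
    nr   : ℕ
    cd   : Node nd nr → Node nd nr → ℚ        -- drone flight times
    cr   : Fin nr → Fin nr → ℚ                -- rover travel times
    emax : ℚ

open DRPE public

-- The neighbourhood N_BS(x,p), x = (v_1,…,v_nd).
-- A sequence is given by the permutation σ (σ ⟨$⟩ʳ i = new position of v_i,
-- 0-based); the sequence itself is (v_{σ⁻¹(1)},…).

InNBS : (n p : ℕ) → Permutation′ n → Set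
InNBS n p σ = ∀ (i j : Fin n) → toℕ i + p ≤ toℕ j → toℕ (σ ⟨$⟩ʳ i) < toℕ (σ ⟨$⟩ʳ j)

seqOf : (n : ℕ) → Permutation′ n → List (Fin n)
seqOf n σ = List.tabulate (λ pos → σ ⟨$⟩ˡ pos)

firstK : (n : ℕ) → Permutation′ n → ℕ → Subset n
firstK n σ k = tabulate (λ i → does (toℕ (σ ⟨$⟩ʳ i) <? k))

chain : (I : DRPE) → Node (nd I) (nr I) → List (Fin (nd I)) → Node (nd I) (nr I) → ℚ
chain I a []       b = cd I a b
chain I a (d ∷ ds) b = cd I a (inj₁ d) ℚ.+ chain I (inj₁ d) ds b

record Operation (I : DRPE) : Set where
  constructor op
  field
    start : Fin (nr I)
    dests : List (Fin (nd I))
    end   : Fin (nr I)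

WellFormedOp : (I : DRPE) → Operation I → Set
WellFormedOp I (op w ds w') = (ds ≢ []) × Unique ds

FlightTime : (I : DRPE) → Operation I → ℚ
FlightTime I (op w ds w') = chain I (inj₂ w) ds (inj₂ w')

Feasible : (I : DRPE) → Operation I → Set
Feasible I o = FlightTime I o ℚ.≤ emax I

destSet : (n : ℕ) → List (Fin n) → Subset n
destSet n []       = ⊥
destSet n (d ∷ ds) = ⁅ d ⁆ ∪ destSet n ds

data Piece (I : DRPE) : Set where
  leg  : Fin (nr I) → Fin (nr I) → Piece I          -- recharging leg (w,w')
  oper : Operation I → Piece I

pStart : {I : DRPE} → Piece I → Fin (nr I)
pStart (leg w w') = w
pStart (oper o)   = Operation.start o

pEnd : {I : DRPE} → Piece I → Fin (nr I)
pEnd (leg w w') = w'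
pEnd (oper o)   = Operation.end o

isLeg : {I : DRPE} → Piece I → Bool
isLeg (leg _ _)  = true
isLeg (oper _)   = false

WellFormedPiece : (I : DRPE) → Piece I → Set
WellFormedPiece I (leg _ _) = ⊤
WellFormedPiece I (oper o)  = WellFormedOp I o

Adjacent : (I : DRPE) → Piece I → Piece I → Set
Adjacent I a b = (isLeg a ≢ isLeg b) × (pEnd a ≡ pStart b)

pieceDests : {I : DRPE} → Piece I → List (Fin (nd I))
pieceDests (leg _ _) = []
pieceDests (oper o)  = Operation.dests o

visitOrder : {I : DRPE} → List (Piece I) → List (Fin (nd I))
visitOrder = concatMap pieceDests

record DroneTour (I : DRPE) : Set where
  field
    pieces      : List (Piece I)
    wellFormed  : All (WellFormedPiece I) pieces
    alternating : Linked (Adjacent I) pieces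
    exactlyOnce : visitOrder pieces ↭ allFin (nd I)

InNBSR : (I : DRPE) → ℕ → DroneTour I → Set
InNBSR I p t = ∃ λ σ → InNBS (nd I) p σ × (visitOrder (DroneTour.pieces t) ≡ seqOf (nd I) σ)

ValidOp : (I : DRPE) → ℕ → Operation I → Set
ValidOp I p o = ∃ λ (t : DroneTour I) → InNBSR I p t × (oper o LMem.∈ DroneTour.pieces t)

-- the operation set wSw' belongs to OP*_BS-R : it is nonempty, i.e. there is
-- a feasible valid operation wsw' with {s} = S
InOPstar : (I : DRPE) → ℕ → Fin (nr I) → Subset (nd I) → Fin (nr I) → Set
InOPstar I p w S w' =
  ∃ λ (ds : List (Fin (nd I))) →
    let o = op w ds w' in
    WellFormedOp I o × Feasible I o × ValidOp I p o × (destSet (nd I) ds ≡ S)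

-- (S,w) is a valid metastate at stage k (validity does not depend on w)
ValidMetastate : (I : DRPE) → ℕ → (k : ℕ) → Subset (nd I) → Set
ValidMetastate I p k S = (∣ S ∣ ≡ k) × (∃ λ σ → InNBS (nd I) p σ × (firstK (nd I) σ k ≡ S))

Arc : (I : DRPE) → ℕ → Subset (nd I) → Fin (nr I) → Subset (nd I) → Fin (nr I) → Set
Arc I p S w T w' = (S ≡ T) ⊎ ((S ⊂ T) × InOPstar I p w (T ─ S) w')

-- Encoding.  Indices l ∈ {1,…,n_d} are represented by Fin n_d (l ↔ l-1).

-- S⁻_k = { l ≥ k+1 : v_l ∈ S }
Sminus : (n : ℕ) → ℕ → Subset n → Subset n
Sminus n k S = tabulate (λ i → does (k ℕ.≤? toℕ i)) ∩ S

-- S⁺_k = { h ≤ k : v_h ∉ S }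
Splus : (n : ℕ) → ℕ → Subset n → Subset n
Splus n k S = tabulate (λ i → does (toℕ i <? k)) ─ S

-- { l : lo < l ≤ hi } (1-based), i.e. {lo+1,…,hi}
range : (n : ℕ) → ℕ → ℕ → Subset n
range n lo hi = tabulate (λ i → does (lo ℕ.≤? toℕ i)) ∩ tabulate (λ i → does (toℕ i <? hi))

atMost : (n : ℕ) → ℕ → Subset n
atMost n b = tabulate (λ i → does (toℕ i <? b))

above : (n : ℕ) → ℕ → Subset n
above n b = tabulate (λ i → does (b ℕ.≤? toℕ i))

CondA : (n k h : ℕ) → Subset n → Subset n → Set
CondA n k h S T = (h ≡ 0) × (Sminus n (k + h) T ≡ Sminus n k S) × (Splus n (k + h) T ≡ Splus n k S)

Hset : (n k h : ℕ) → Subset n → Subset n → Subset n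
Hset n k h S T =
  ((range n k (k + h) ∪ Splus n k S) ∪ Sminus n (k + h) T) ─ (Splus n (k + h) T ∪ Sminus n k S)

CondB : (I : DRPE) → ℕ → (k h : ℕ) → Subset (nd I) → Fin (nr I) → Subset (nd I) → Fin (nr I) → Set
CondB I p k h S w T w' =
  (1 ≤ h)
  × InOPstar I p w (Hset (nd I) k h S T) w'
  × ((Sminus (nd I) k S ∩ above (nd I) (k + h)) ⊆ Sminus (nd I) (k + h) T)
  × Empty ((Sminus (nd I) k S ∩ atMost (nd I) (k + h)) ∩ Splus (nd I) (k + h) T)
  × ((Splus (nd I) (k + h) T ∩ atMost (nd I) k) ⊆ Splus (nd I) k S)

{-# OPTIONS --safe #-}
module Submission where

-- Membership of an index in any of the sets involved depends only on whether the index lies in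
-- [1, k], (k, k + h] or (k + h, n_d], and on whether it lies in S and in T.  Comparing truth tables
-- on these three ranges shows that H is just T ∖ S, that the three inclusions of (b) say exactly
-- S ⊆ T on the three ranges, and that (a) says S = T, because S = ([k] ∖ S⁺ₖ) ∪ S⁻ₖ.  The
-- cardinalities |S| = k and |T| = k + h then match S = T with h = 0 and S ⊂ T with h ≥ 1, and an
-- arc S ⊆ T is strict because the operation set w(T ∖ S)w' is nonempty.

open import Defs
open import Data.Nat using (ℕ; _+_)
open import Data.Fin using (Fin)
open import Data.Fin.Subset using (Subset)
open import Data.Sum using (_⊎_)
open import Function.Bundles using (_⇔_)

open import Data.Bool using (Bool; true; false; not; _∧_; _∨_)
open import Data.Bool.Properties using (∧-zeroʳ; ∧-identityʳ)
open import Data.Empty using (⊥-elim)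
open import Data.Fin using (zero; suc; toℕ)
open import Data.Fin.Subset using (⊥; _∈_; _∉_; _⊆_; _∩_; _∪_; _─_; Nonempty; Empty; ∣_∣)
open import Data.Fin.Subset.Properties
  using (_∈?_; ∉⊥; Empty-unique; p⊆p∪q; q⊆p∪q; ∪-identityʳ; p─q⊆p; x∈p∧x∉q⇒x∈p─q; x∈⁅x⁆; x∈p∪q⁺; p⊂q⇒∣p∣<∣q∣)
open import Data.List using ([]; _∷_)
open import Data.Nat using (_≤_; _<_; _<?_; _≤?_)
open import Data.Nat.Properties using (+-identityʳ; +-cancelˡ-≡; +-cancelˡ-<; m≤m+n; ≤-refl; <-≤-trans; <⇒≱; ≮⇒≥)
open import Data.Product using (_×_; _,_)
open import Data.Product.Function.NonDependent.Propositional using (_×-⇔_)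
open import Data.Sum using (inj₁; inj₂)
open import Data.Sum.Function.Propositional using (_⊎-⇔_)
open import Data.Vec using (_∷_; there; lookup; tabulate)
open import Data.Vec.Properties using (lookup-zipWith; lookup∘tabulate; tabulate∘lookup; tabulate-cong)
open import Function.Bundles using (mk⇔)
import Function.Properties.Equivalence as ⇔
open import Relation.Nullary using (does; yes; no; contradiction)
open import Relation.Nullary.Decidable using (dec-true; dec-false; decidable-stable)
open import Relation.Binary.PropositionalEquality using (_≡_; refl; sym; trans; cong; cong₂; subst; subst₂; module ≡-Reasoning)

private
  variable
    n k m : ℕ
    p q S T : Subset n

lookup-∩ : ∀ (p q : Subset n) i → lookup (p ∩ q) i ≡ lookup p i ∧ lookup q i
lookup-∩ p q i = lookup-zipWith _∧_ i p q

lookup-∪ : ∀ (p q : Subset n) i → lookup (p ∪ q) i ≡ lookup p i ∨ lookup q i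
lookup-∪ p q i = lookup-zipWith _∨_ i p q

lookup-─ : ∀ (p q : Subset n) i → lookup (p ─ q) i ≡ lookup p i ∧ not (lookup q i)
lookup-─ (s ∷ p) (true  ∷ q) zero    = sym (∧-zeroʳ s)
lookup-─ (s ∷ p) (false ∷ q) zero    = sym (∧-identityʳ s)
lookup-─ (s ∷ p) (t     ∷ q) (suc i) = lookup-─ p q i

lookup-ext : (∀ i → lookup p i ≡ lookup q i) → p ≡ q
lookup-ext {p = p} {q} eq = begin
  p                      ≡⟨ tabulate∘lookup p ⟨
  tabulate (lookup p)    ≡⟨ tabulate-cong eq ⟩
  tabulate (lookup q)    ≡⟨ tabulate∘lookup q ⟩
  q                      ∎
  where open ≡-Reasoning

x∈p─q⇒x∉q : ∀ (p q : Subset n) {x} → x ∈ p ─ q → x ∉ q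
x∈p─q⇒x∉q (s ∷ p) (t ∷ q) (there x∈p─q) (there x∈q) = x∈p─q⇒x∉q p q x∈p─q x∈q

⊆⇔─≡⊥ : p ⊆ q ⇔ p ─ q ≡ ⊥
⊆⇔─≡⊥ {p = p} {q} = mk⇔ to from
  where
  to : p ⊆ q → p ─ q ≡ ⊥
  to p⊆q = Empty-unique λ (x , x∈p─q) → x∈p─q⇒x∉q p q x∈p─q (p⊆q (p─q⊆p p q x∈p─q))
  from : p ─ q ≡ ⊥ → p ⊆ q
  from p─q≡⊥ {x} x∈p = decidable-stable (x ∈? q)
    λ x∉q → ∉⊥ (subst (x ∈_) p─q≡⊥ (x∈p∧x∉q⇒x∈p─q x∈p x∉q))

Empty⇔≡⊥ : Empty p ⇔ p ≡ ⊥
Empty⇔≡⊥ = mk⇔ Empty-unique λ { refl (_ , x∈⊥) → ∉⊥ x∈⊥ }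

∪≡⊥⇔ : p ∪ q ≡ ⊥ ⇔ (p ≡ ⊥ × q ≡ ⊥)
∪≡⊥⇔ {p = p} {q} = mk⇔
  (λ p∪q≡⊥ → ⊆⊥⇒≡⊥ p∪q≡⊥ (p⊆p∪q q) , ⊆⊥⇒≡⊥ p∪q≡⊥ (q⊆p∪q p q))
  (λ { (refl , refl) → ∪-identityʳ ⊥ })
  where
  ⊆⊥⇒≡⊥ : ∀ {r s : Subset _} → s ≡ ⊥ → r ⊆ s → r ≡ ⊥
  ⊆⊥⇒≡⊥ s≡⊥ r⊆s = Empty-unique λ (x , x∈r) → ∉⊥ (subst (x ∈_) s≡⊥ (r⊆s x∈r))

below : ℕ → Fin n → Bool
below b i = does (toℕ i <? b)

does-≤?-not-< : ∀ b j → does (b ≤? j) ≡ not (does (j <? b))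
does-≤?-not-< b j with j <? b
... | yes j<b = trans (dec-false (b ≤? j) (<⇒≱ j<b)) (cong not (sym (dec-true (j <? b) j<b)))
... | no j≮b  = trans (dec-true (b ≤? j) (≮⇒≥ j≮b)) (cong not (sym (dec-false (j <? b) j≮b)))

below-mono : k ≤ m → (i : Fin n) → below k i ≡ true → below m i ≡ true
below-mono {k} {m} k≤m i below-k with toℕ i <? k
... | yes i<k = dec-true (toℕ i <? m) (<-≤-trans i<k k≤m)
... | no i≮k  = contradiction (trans (sym below-k) (dec-false (toℕ i <? k) i≮k)) λ ()

-- Every set in the statement is a Boolean combination of the threshold sets for k and m and of
-- S and T, so identities between such sets are truth tables in the bits a = [i < k], b = [i < m],
-- s = [i ∈ S], t = [i ∈ T]; the hypothesis a ⇒ b of a table records k ≤ m.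
infixr 7 _∩ₑ_
infixr 6 _∪ₑ_
infixl 5 _─ₑ_

data SetExpr : Set where
  atMostₖ aboveₖ atMostₘ aboveₘ Sₑ Tₑ : SetExpr
  _∩ₑ_ _∪ₑ_ _─ₑ_ : SetExpr → SetExpr → SetExpr

⟦_⟧ˢ : SetExpr → ℕ → ℕ → Subset n → Subset n → Subset n
⟦_⟧ˢ {n} atMostₖ k m S T = atMost n k
⟦_⟧ˢ {n} aboveₖ  k m S T = above n k
⟦_⟧ˢ {n} atMostₘ k m S T = atMost n m
⟦_⟧ˢ {n} aboveₘ  k m S T = above n m
⟦ Sₑ ⟧ˢ      k m S T = S
⟦ Tₑ ⟧ˢ      k m S T = T
⟦ e ∩ₑ f ⟧ˢ  k m S T = ⟦ e ⟧ˢ k m S T ∩ ⟦ f ⟧ˢ k m S T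
⟦ e ∪ₑ f ⟧ˢ  k m S T = ⟦ e ⟧ˢ k m S T ∪ ⟦ f ⟧ˢ k m S T
⟦ e ─ₑ f ⟧ˢ  k m S T = ⟦ e ⟧ˢ k m S T ─ ⟦ f ⟧ˢ k m S T

⟦_⟧ᵇ : SetExpr → Bool → Bool → Bool → Bool → Bool
⟦ atMostₖ ⟧ᵇ a b s t = a
⟦ aboveₖ  ⟧ᵇ a b s t = not a
⟦ atMostₘ ⟧ᵇ a b s t = b
⟦ aboveₘ  ⟧ᵇ a b s t = not b
⟦ Sₑ ⟧ᵇ      a b s t = s
⟦ Tₑ ⟧ᵇ      a b s t = t
⟦ e ∩ₑ f ⟧ᵇ  a b s t = ⟦ e ⟧ᵇ a b s t ∧ ⟦ f ⟧ᵇ a b s t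
⟦ e ∪ₑ f ⟧ᵇ  a b s t = ⟦ e ⟧ᵇ a b s t ∨ ⟦ f ⟧ᵇ a b s t
⟦ e ─ₑ f ⟧ᵇ  a b s t = ⟦ e ⟧ᵇ a b s t ∧ not (⟦ f ⟧ᵇ a b s t)

lookup-⟦⟧ : ∀ e (S T : Subset n) i →
  lookup (⟦ e ⟧ˢ k m S T) i ≡ ⟦ e ⟧ᵇ (below k i) (below m i) (lookup S i) (lookup T i)
lookup-⟦⟧ {k = k} atMostₖ S T i = lookup∘tabulate (below k) i
lookup-⟦⟧ {k = k} aboveₖ  S T i = trans (lookup∘tabulate _ i) (does-≤?-not-< k (toℕ i))
lookup-⟦⟧ {m = m} atMostₘ S T i = lookup∘tabulate (below m) i
lookup-⟦⟧ {m = m} aboveₘ  S T i = trans (lookup∘tabulate _ i) (does-≤?-not-< m (toℕ i))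
lookup-⟦⟧ Sₑ S T i = refl
lookup-⟦⟧ Tₑ S T i = refl
lookup-⟦⟧ {k = k} {m} (e ∩ₑ f) S T i =
  trans (lookup-∩ (⟦ e ⟧ˢ k m S T) _ i) (cong₂ _∧_ (lookup-⟦⟧ e S T i) (lookup-⟦⟧ f S T i))
lookup-⟦⟧ {k = k} {m} (e ∪ₑ f) S T i =
  trans (lookup-∪ (⟦ e ⟧ˢ k m S T) _ i) (cong₂ _∨_ (lookup-⟦⟧ e S T i) (lookup-⟦⟧ f S T i))
lookup-⟦⟧ {k = k} {m} (e ─ₑ f) S T i =
  trans (lookup-─ (⟦ e ⟧ˢ k m S T) _ i) (cong₂ (λ x y → x ∧ not y) (lookup-⟦⟧ e S T i) (lookup-⟦⟧ f S T i))

TruthTable : SetExpr → SetExpr → Set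
TruthTable e f = ∀ a b s t → (a ≡ true → b ≡ true) → ⟦ e ⟧ᵇ a b s t ≡ ⟦ f ⟧ᵇ a b s t

⟦⟧-≡ : ∀ e f → TruthTable e f → k ≤ m → ⟦ e ⟧ˢ k m S T ≡ ⟦ f ⟧ˢ k m S T
⟦⟧-≡ {k = k} {m} {S = S} {T} e f table k≤m = lookup-ext λ i → begin
  lookup (⟦ e ⟧ˢ k m S T) i                                 ≡⟨ lookup-⟦⟧ e S T i ⟩
  ⟦ e ⟧ᵇ (below k i) (below m i) (lookup S i) (lookup T i)  ≡⟨ table _ _ _ _ (below-mono k≤m i) ⟩
  ⟦ f ⟧ᵇ (below k i) (below m i) (lookup S i) (lookup T i)  ≡⟨ lookup-⟦⟧ f S T i ⟨
  lookup (⟦ f ⟧ˢ k m S T) i                                 ∎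
  where open ≡-Reasoning

encoding-decode : (atMost n k ─ Splus n k S) ∪ Sminus n k S ≡ S
encoding-decode {k = k} = ⟦⟧-≡ {T = ⊥} D Sₑ table (≤-refl {k})
  where
  D : SetExpr
  D = (atMostₖ ─ₑ (atMostₖ ─ₑ Sₑ)) ∪ₑ (aboveₖ ∩ₑ Sₑ)
  table : TruthTable D Sₑ
  table true  _ true  _ _ = refl
  table true  _ false _ _ = refl
  table false _ true  _ _ = refl
  table false _ false _ _ = refl

encoding-injective : Sminus n k S ≡ Sminus n k T → Splus n k S ≡ Splus n k T → S ≡ T
encoding-injective {n} {k} {S} {T} S⁻≡T⁻ S⁺≡T⁺ = begin
  S                                              ≡⟨ encoding-decode {k = k} ⟨
  (atMost n k ─ Splus n k S) ∪ Sminus n k S      ≡⟨ cong₂ (λ P M → (atMost n k ─ P) ∪ M) S⁺≡T⁺ S⁻≡T⁻ ⟩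
  (atMost n k ─ Splus n k T) ∪ Sminus n k T      ≡⟨ encoding-decode {k = k} ⟩
  T                                              ∎
  where open ≡-Reasoning

Hset≡─ : ∀ k h → Hset n k h S T ≡ T ─ S
Hset≡─ k h = ⟦⟧-≡ H (Tₑ ─ₑ Sₑ) table (m≤m+n k h)
  where
  H : SetExpr
  H = (((aboveₖ ∩ₑ atMostₘ) ∪ₑ (atMostₖ ─ₑ Sₑ)) ∪ₑ (aboveₘ ∩ₑ Tₑ)) ─ₑ ((atMostₘ ─ₑ Tₑ) ∪ₑ (aboveₖ ∩ₑ Sₑ))
  table : TruthTable H (Tₑ ─ₑ Sₑ)
  table true  true  true  true  _ = refl
  table true  true  true  false _ = refl
  table true  true  false true  _ = refl
  table true  true  false false _ = refl
  table true  false _     _     a⇒b = contradiction (a⇒b refl) λ ()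
  table false true  true  true  _ = refl
  table false true  true  false _ = refl
  table false true  false true  _ = refl
  table false true  false false _ = refl
  table false false true  true  _ = refl
  table false false true  false _ = refl
  table false false false true  _ = refl
  table false false false false _ = refl

-- The three sets that (b) requires to be empty (as differences) split S ∖ T by range.
violations≡─ : k ≤ m →
  ((Sminus n k S ∩ above n m) ─ Sminus n m T)
    ∪ ((Sminus n k S ∩ atMost n m) ∩ Splus n m T)
    ∪ ((Splus n m T ∩ atMost n k) ─ Splus n k S)
  ≡ S ─ T
violations≡─ = ⟦⟧-≡ V (Sₑ ─ₑ Tₑ) table
  where
  V : SetExpr
  V = (((aboveₖ ∩ₑ Sₑ) ∩ₑ aboveₘ) ─ₑ (aboveₘ ∩ₑ Tₑ))
      ∪ₑ (((aboveₖ ∩ₑ Sₑ) ∩ₑ atMostₘ) ∩ₑ (atMostₘ ─ₑ Tₑ))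
      ∪ₑ (((atMostₘ ─ₑ Tₑ) ∩ₑ atMostₖ) ─ₑ (atMostₖ ─ₑ Sₑ))
  table : TruthTable V (Sₑ ─ₑ Tₑ)
  table true  true  true  true  _ = refl
  table true  true  true  false _ = refl
  table true  true  false true  _ = refl
  table true  true  false false _ = refl
  table true  false _     _     a⇒b = contradiction (a⇒b refl) λ ()
  table false true  true  true  _ = refl
  table false true  true  false _ = refl
  table false true  false true  _ = refl
  table false true  false false _ = refl
  table false false true  true  _ = refl
  table false false true  false _ = refl
  table false false false true  _ = refl
  table false false false false _ = refl

RegionwiseSubset : (n k m : ℕ) → Subset n → Subset n → Set
RegionwiseSubset n k m S T =
  (Sminus n k S ∩ above n m ⊆ Sminus n m T)
  × Empty ((Sminus n k S ∩ atMost n m) ∩ Splus n m T)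
  × (Splus n m T ∩ atMost n k ⊆ Splus n k S)

RegionwiseSubset⇔⊆ : k ≤ m → RegionwiseSubset n k m S T ⇔ S ⊆ T
RegionwiseSubset⇔⊆ k≤m =
  ⇔.trans (⊆⇔─≡⊥ ×-⇔ Empty⇔≡⊥ ×-⇔ ⊆⇔─≡⊥)
  (⇔.trans (⇔.sym (⇔.trans ∪≡⊥⇔ (⇔.refl ×-⇔ ∪≡⊥⇔)))
  (⇔.trans (mk⇔ (trans (sym (violations≡─ k≤m))) (trans (violations≡─ k≤m)))
  (⇔.sym ⊆⇔─≡⊥)))

CondA⇔ : ∀ k h → CondA n k h S T ⇔ (h ≡ 0 × S ≡ T)
CondA⇔ {n} {S} {T} k h = mk⇔ to from
  where
  to : CondA n k h S T → h ≡ 0 × S ≡ T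
  to (refl , T⁻≡S⁻ , T⁺≡S⁺) rewrite +-identityʳ k = refl , sym (encoding-injective {k = k} T⁻≡S⁻ T⁺≡S⁺)
  from : h ≡ 0 × S ≡ T → CondA n k h S T
  from (refl , refl) rewrite +-identityʳ k = refl , refl , refl

InOPstar⇒Nonempty : ∀ {I p w w'} {X : Subset (nd I)} → InOPstar I p w X w' → Nonempty X
InOPstar⇒Nonempty ([]     , ([]≢[] , _) , _)  = ⊥-elim ([]≢[] refl)
InOPstar⇒Nonempty (d ∷ ds , _ , _ , _ , refl) = d , x∈p∪q⁺ (inj₁ (x∈⁅x⁆ d))

Arc⇔ : ∀ {I p w w'} {S T : Subset (nd I)} h → ∣ S ∣ ≡ k → ∣ T ∣ ≡ k + h →
  Arc I p S w T w' ⇔ ((h ≡ 0 × S ≡ T) ⊎ (1 ≤ h × InOPstar I p w (T ─ S) w' × S ⊆ T))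
Arc⇔ {k = k} {I} {p} {w} {w'} {S} {T} h ∣S∣≡k ∣T∣≡k+h = mk⇔ to from
  where
  to : Arc I p S w T w' → (h ≡ 0 × S ≡ T) ⊎ (1 ≤ h × InOPstar I p w (T ─ S) w' × S ⊆ T)
  to (inj₁ refl) = inj₁ (+-cancelˡ-≡ k h 0 (trans (sym ∣T∣≡k+h) (trans ∣S∣≡k (sym (+-identityʳ k)))) , refl)
  to (inj₂ (S⊂T@(S⊆T , _) , ops)) = inj₂ (+-cancelˡ-< k 0 h k+0<k+h , ops , S⊆T)
    where
    k+0<k+h : k + 0 < k + h
    k+0<k+h = subst₂ _<_ (trans ∣S∣≡k (sym (+-identityʳ k))) ∣T∣≡k+h (p⊂q⇒∣p∣<∣q∣ S⊂T)
  from : (h ≡ 0 × S ≡ T) ⊎ (1 ≤ h × InOPstar I p w (T ─ S) w' × S ⊆ T) → Arc I p S w T w'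
  from (inj₁ (_ , refl)) = inj₁ refl
  from (inj₂ (_ , ops , S⊆T)) with InOPstar⇒Nonempty ops
  ... | x , x∈T─S = inj₂ ((S⊆T , x , p─q⊆p T S x∈T─S , x∈p─q⇒x∉q T S x∈T─S) , ops)

≡⇒⇔ : ∀ {A B : Set} → A ≡ B → A ⇔ B
≡⇒⇔ refl = ⇔.refl

proposition3 : (I : DRPE) (p k h : ℕ) (S T : Subset (nd I)) (w w' : Fin (nr I))
    → ValidMetastate I p k S
    → ValidMetastate I p (k + h) T
    → Arc I p S w T w' ⇔ (CondA (nd I) k h S T ⊎ CondB I p k h S w T w')
proposition3 I p k h S T w w' (∣S∣≡k , _) (∣T∣≡k+h , _) =
  ⇔.trans (Arc⇔ h ∣S∣≡k ∣T∣≡k+h)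
    (⇔.sym (CondA⇔ k h)
      ⊎-⇔ ⇔.refl
      ×-⇔ ≡⇒⇔ (cong (λ X → InOPstar I p w X w') (sym (Hset≡─ k h)))
      ×-⇔ ⇔.sym (RegionwiseSubset⇔⊆ (m≤m+n k h)))
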